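{- Let $p\geq5$ be a prime, $d\geq1$ an integer, and $f_d=t^d-dt-1\in\mathbf F_p[t]$. (i) If $p\nmid d(d-1)$ and $\gcd(p-1,d-1)=1$, then $f_d$ is of Lefschetz type. (ii) If in addition $p\nmid d+1$, then $f_d$ is of Katz–Lefschetz type for the elliptic curve $E:y^2=x(x+1)(x-t)$ over $\mathbf F_p(t)$, whose set of finite places of bad reduction is $S=\{0,-1\}$.
   Context: A polynomial $f\in\overline{\mathbf F}_p[t]$ of degree $d\geq1$ is of Lefschetz type if (i) $f$ has $d$ distinct zeros in $\overline{\mathbf F}_p$, and (ii) $f'$ has $d-1$ distinct zeros, whose images under $f$ are distinct. Given a finite set $S\subset\overline{\mathbf F}_p$ (the finite places of bad reduction of an elliptic curve $E$), $f$ is of Katz–Lefschetz type for $E$ if it is of Lefschetz type and moreover: no two points of $S$ have the same image under $f$; $f(s)\neq0$ for $s\in S$; and for each $s\in S$ the fiber $f^{ -1}(f(s))$ has $d$ distinct elements. -}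

module Defs where

open import Level using (Level; _⊔_)
open import Algebra.Bundles using (CommutativeRing)
open import Data.Nat as ℕ using (ℕ; zero; suc; _∸_)
open import Data.Fin using (Fin)
open import Data.List using (List; []; _∷_; length; lookup; _++_)
open import Data.Product using (Σ; ∃; _×_)
open import Relation.Nullary using (¬_)
open import Relation.Binary.PropositionalEquality using (_≡_; _≢_)

record Field (c ℓ : Level) : Set (Level.suc (c ⊔ ℓ)) where
  field
    commRing : CommutativeRing c ℓ
  open CommutativeRing commRing public
  field
    1≉0 : ¬ (1# ≈ 0#)
    inverse : ∀ x → ¬ (x ≈ 0#) → Σ Carrier (λ y → (x * y) ≈ 1#)

module FieldOps {c ℓ} (K : Field c ℓ) where
  open Field K

  ι : ℕ → Carrier
  ι zero    = 0#
  ι (suc n) = 1# + ι n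

  pow : Carrier → ℕ → Carrier
  pow x zero    = 1#
  pow x (suc n) = x * pow x n

  -- polynomials: coefficient lists, lowest degree first
  Poly : Set c
  Poly = List Carrier

  coeff : Poly → ℕ → Carrier
  coeff []       _       = 0#
  coeff (a ∷ as) zero    = a
  coeff (a ∷ as) (suc k) = coeff as k

  eval : Poly → Carrier → Carrier
  eval []       x = 0#
  eval (a ∷ as) x = a + x * eval as x

  _+ₚ_ : Poly → Poly → Poly
  []       +ₚ q        = q
  (a ∷ as) +ₚ []       = a ∷ as
  (a ∷ as) +ₚ (b ∷ bs) = (a + b) ∷ (as +ₚ bs)

  scale : Carrier → Poly → Poly
  scale c []       = []
  scale c (a ∷ as) = (c * a) ∷ scale c as

  X^ : ℕ → Poly
  X^ zero    = 1# ∷ []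
  X^ (suc n) = 0# ∷ X^ n

  const : Carrier → Poly
  const a = a ∷ []

  derivFrom : ℕ → Poly → Poly
  derivFrom k []       = []
  derivFrom k (a ∷ as) = (ι k * a) ∷ derivFrom (suc k) as

  deriv : Poly → Poly
  deriv []       = []
  deriv (a ∷ as) = derivFrom 1 as

  HasDegree : Poly → ℕ → Set ℓ
  HasDegree f d = (¬ (coeff f d ≈ 0#)) × (∀ k → d ℕ.< k → coeff f k ≈ 0#)

  Distinct : ∀ {n} → (Fin n → Carrier) → Set ℓ
  Distinct {n} r = ∀ (i j : Fin n) → i ≢ j → ¬ (r i ≈ r j)

  HasDistinctZeros : Poly → ℕ → Set (c ⊔ ℓ)
  HasDistinctZeros g n =
    Σ (Fin n → Carrier) λ r → Distinct r × (∀ i → eval g (r i) ≈ 0#)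

  LefschetzType : Poly → Set (c ⊔ ℓ)
  LefschetzType f = Σ ℕ λ d →
    HasDegree f d × 1 ℕ.≤ d ×
    HasDistinctZeros f d ×
    (Σ (Fin (d ∸ 1) → Carrier) λ z →
        Distinct z × (∀ i → eval (deriv f) (z i) ≈ 0#)
        × Distinct (λ i → eval f (z i)))

  KatzLefschetzType : List Carrier → Poly → Set (c ⊔ ℓ)
  KatzLefschetzType S f = Σ ℕ λ d →
    HasDegree f d × LefschetzType f ×
    (∀ (i j : Fin (length S)) → ¬ (lookup S i ≈ lookup S j) →
        ¬ (eval f (lookup S i) ≈ eval f (lookup S j))) ×
    (∀ (i : Fin (length S)) → ¬ (eval f (lookup S i) ≈ 0#)) ×
    (∀ (i : Fin (length S)) →
        Σ (Fin d → Carrier) λ r → Distinct r ×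
          (∀ k → eval f (r k) ≈ eval f (lookup S i)))

  fpoly : ℕ → Poly
  fpoly d = X^ d +ₚ (scale (- ι d) (X^ 1) +ₚ const (- 1#))

  Sbad : List Carrier
  Sbad = 0# ∷ (- 1#) ∷ []

record AlgClosedField (c ℓ : Level) : Set (Level.suc (c ⊔ ℓ)) where
  field
    field' : Field c ℓ
  open Field field' public
  open FieldOps field' public
  field
    -- every monic polynomial of degree ≥ 1 has a root
    closed : ∀ (a : Poly) → 1 ℕ.≤ length a →
      Σ Carrier λ x → eval (a ++ (1# ∷ [])) x ≈ 0#

CharP : ∀ {c ℓ} → AlgClosedField c ℓ → ℕ → Set ℓ
CharP K p = ι p ≈ 0#
  where open AlgClosedField K

-- The derivative of f = tᵈ - d t - 1 is d (tᵐ - 1) with m = d - 1, so the critical points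
-- are the m distinct m-th roots of unity ζ, and f(ζ) = -m ζ - 1, so the critical values are
-- pairwise distinct.  If v is not a critical value then f - v is separable and so has d
-- distinct roots in the algebraically closed field (split them off one at a time by
-- synthetic division).  A critical value v = f(ζ) satisfies -m ζ = v + 1.  For v = f(0) = -1
-- this forces ζ = 0.  For v = 0 and v = f(-1) = d (d is even as gcd(p - 1, d - 1) = 1),
-- c = v + 1 is a nonzero element of 𝔽ₚ and (-m)ᵐ = cᵐ, hence -m = c because x ↦ xᵐ is
-- injective on 𝔽ₚ^× (Fermat and gcd(p - 1, m) = 1); then p divides d, resp. 2d.

module Submission where

open import Defs
open import Level using (_⊔_)
open import Data.Nat as ℕ using (ℕ; zero; suc; _≤_; _∸_; _!; z≤n; s≤s)
import Data.Nat.Properties as ℕ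
open import Data.Fin using (Fin; zero; suc; toℕ; inject₁; fromℕ)
open import Data.Fin.Properties using (toℕ-inject₁; toℕ<n; toℕ-fromℕ)
open import Function using (_∘_)
open import Data.List using ([]; _∷_; length; _++_; [_]; lookup)
open import Data.Product using (Σ-syntax; _×_; _,_)
import Data.Vec.Functional as Vector
open import Data.Sum using (_⊎_; inj₁; inj₂; fromInj₁)
open import Data.Empty using (⊥-elim)
open import Data.Nat.Divisibility
  using (_∣_; divides; _∣0; ∣-refl; ∣⇒≤; ∣1⇒≡1; ∣m∣n⇒∣m+n; m∣m*n; ∣m⇒∣m*n; ∣n⇒∣m*n)
open import Data.Nat.Coprimality using (Coprime; coprime-Bézout; gcd≡1⇒coprime)
open import Data.Nat.GCD using (module Bézout)
open import Data.Nat.Primality using (Prime; euclidsLemma; prime⇒irreducible; ¬prime[1])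
open import Data.Nat.Combinatorics using (_C_; nCn≡1; k![n∸k]!∣n!)
open import Data.Nat.Combinatorics.Specification using (nCk≡n!/k![n-k]!)
open import Data.Nat.DivMod using (m/n*n≡m)
open import Data.Nat.Tactic.RingSolver using (solve-∀)
open import Relation.Nullary using (¬_; contradiction)
open import Relation.Binary.PropositionalEquality as ≡ using (_≡_; _≢_)

2∣n⊎2∣1+n : ∀ n → 2 ∣ n ⊎ 2 ∣ suc n
2∣n⊎2∣1+n zero    = inj₁ (2 ∣0)
2∣n⊎2∣1+n (suc n) with 2∣n⊎2∣1+n n
... | inj₁ 2∣n   = inj₂ (∣m∣n⇒∣m+n (∣-refl {2}) 2∣n)
... | inj₂ 2∣1+n = inj₁ 2∣1+n

odd-prime⇒2∣p-1 : ∀ {p-1} → Prime (suc p-1) → 2 ℕ.< suc p-1 → 2 ∣ p-1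
odd-prime⇒2∣p-1 {p-1} p-prime 2<p with 2∣n⊎2∣1+n p-1
... | inj₁ 2∣p-1 = 2∣p-1
... | inj₂ 2∣p   with prime⇒irreducible p-prime 2∣p
...   | inj₁ ()
...   | inj₂ 2≡p = contradiction 2≡p (ℕ.<⇒≢ 2<p)

coprime-to-even⇒2∣1+n : ∀ {a n} → Coprime a n → 2 ∣ a → 2 ∣ suc n
coprime-to-even⇒2∣1+n {n = n} coprime 2∣a with 2∣n⊎2∣1+n n
... | inj₁ 2∣n   with () ← coprime (2∣a , 2∣n)
... | inj₂ 2∣1+n = 2∣1+n

prime∤⇒coprime : ∀ {p n} → Prime p → ¬ p ∣ n → Coprime p n
prime∤⇒coprime p-prime p∤n (d∣p , d∣n) with prime⇒irreducible p-prime d∣p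
... | inj₁ d≡1   = d≡1
... | inj₂ ≡.refl = contradiction d∣n p∤n

prime∤! : ∀ {p n} → Prime p → n ℕ.< p → ¬ p ∣ n !
prime∤! {n = zero}  p-prime _   p∣1  = ¬prime[1] (≡.subst Prime (∣1⇒≡1 p∣1) p-prime)
prime∤! {n = suc n} p-prime n<p p∣n! with euclidsLemma (suc n) (n !) p-prime p∣n!
... | inj₁ p∣1+n = ℕ.<⇒≱ n<p (∣⇒≤ p∣1+n)
... | inj₂ p∣n!′ = prime∤! p-prime (ℕ.<-trans (ℕ.n<1+n n) n<p) p∣n!′

-- p divides p! = (p C k) · k! · (p - k)!, but neither k! nor (p - k)!.
prime∣pCk : ∀ {p k} → Prime p → 0 ℕ.< k → k ℕ.< p → p ∣ p C k
prime∣pCk {suc p-1} {k} p-prime 0<k k<p = fromInj₁ (⊥-elim ∘ p∤D) (euclidsLemma (p C k) D p-prime p∣C*D)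
  where
  p = suc p-1
  D = k ! ℕ.* (p ∸ k) !
  k≤p = ℕ.<⇒≤ k<p
  instance _ = k ℕ.!* (p ∸ k) !≢0
  C*D≡p! : (p C k) ℕ.* D ≡ p !
  C*D≡p! = ≡.trans (≡.cong (ℕ._* D) (nCk≡n!/k![n-k]! k≤p)) (m/n*n≡m (k![n∸k]!∣n! k≤p))
  p∣C*D : p ∣ (p C k) ℕ.* D
  p∣C*D = ≡.subst (p ∣_) (≡.sym C*D≡p!) (m∣m*n (p-1 !))
  p∤D : ¬ p ∣ D
  p∤D p∣D with euclidsLemma (k !) ((p ∸ k) !) p-prime p∣D
  ... | inj₁ p∣k!     = prime∤! p-prime k<p p∣k!
  ... | inj₂ p∣[p-k]! = prime∤! p-prime (ℕ.∸-monoʳ-< 0<k k≤p) p∣[p-k]!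

2+m+m≡2*[1+m] : ∀ m → 2 ℕ.+ m ℕ.+ m ≡ 2 ℕ.* suc m
2+m+m≡2*[1+m] = solve-∀

module FieldProperties {c ℓ} (F : Field c ℓ) where
  open Field F hiding (zero)
  open FieldOps F
  open import Algebra.Properties.Ring ring public
  import Algebra.Properties.Semiring.Mult semiring as Mult
  open import Algebra.Properties.Semiring.Exp semiring public
  open import Algebra.Solver.Ring.NaturalCoefficients.Default commutativeSemiring
    public using (solve; _:=_; _:+_; _:*_; con)
  open import Algebra.Properties.Monoid.Sum +-monoid using (sum; sum-init-last; sum-cong-≋; sum-replicate-zero)
  open import Relation.Binary.Reasoning.Setoid setoid

  ι≡×1 : ∀ n → ι n ≡ n Mult.× 1#
  ι≡×1 zero    = ≡.refl
  ι≡×1 (suc n) = ≡.cong (1# +_) (ι≡×1 n)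

  ι-homo-+ : ∀ m n → ι (m ℕ.+ n) ≈ ι m + ι n
  ι-homo-+ m n rewrite ι≡×1 (m ℕ.+ n) | ι≡×1 m | ι≡×1 n = Mult.×-homo-+ 1# m n

  ι-homo-* : ∀ m n → ι (m ℕ.* n) ≈ ι m * ι n
  ι-homo-* m n rewrite ι≡×1 (m ℕ.* n) | ι≡×1 m | ι≡×1 n = Mult.×1-homo-* m n

  ×≈ι* : ∀ n x → n Mult.× x ≈ ι n * x
  ×≈ι* n x rewrite ι≡×1 n = begin
    n Mult.× x          ≈⟨ Mult.×-congʳ n (*-identityˡ x) ⟨
    n Mult.× (1# * x)   ≈⟨ Mult.×-assoc-* n 1# x ⟨
    (n Mult.× 1#) * x   ∎

  1^n≈1 : ∀ n → 1# ^ n ≈ 1#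
  1^n≈1 zero    = refl
  1^n≈1 (suc n) = trans (*-identityˡ _) (1^n≈1 n)

  *-cancelˡ : ∀ {x y z} → ¬ x ≈ 0# → x * y ≈ x * z → y ≈ z
  *-cancelˡ {x} {y} {z} x≉0 xy≈xz with inverse x x≉0
  ... | x⁻¹ , xx⁻¹≈1 = begin
    y              ≈⟨ *-identityˡ y ⟨
    1# * y         ≈⟨ *-congʳ (trans (sym xx⁻¹≈1) (*-comm x x⁻¹)) ⟩
    x⁻¹ * x * y    ≈⟨ *-assoc x⁻¹ x y ⟩
    x⁻¹ * (x * y)  ≈⟨ *-congˡ xy≈xz ⟩
    x⁻¹ * (x * z)  ≈⟨ *-assoc x⁻¹ x z ⟨
    x⁻¹ * x * z    ≈⟨ *-congʳ (trans (*-comm x⁻¹ x) xx⁻¹≈1) ⟩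
    1# * z         ≈⟨ *-identityˡ z ⟩
    z              ∎

  ι-*-zero : ∀ k {n} → ι n ≈ 0# → ι (k ℕ.* n) ≈ 0#
  ι-*-zero k ιn≈0 = trans (ι-homo-* k _) (trans (*-congˡ ιn≈0) (zeroʳ (ι k)))

  ι≈0∧ι≈0⇒1+a≢b : ∀ {a b} → ι a ≈ 0# → ι b ≈ 0# → suc a ≢ b
  ι≈0∧ι≈0⇒1+a≢b {a} ιa≈0 ιb≈0 ≡.refl = 1≉0 (begin
    1#           ≈⟨ +-identityʳ 1# ⟨
    1# + 0#      ≈⟨ +-congˡ ιa≈0 ⟨
    ι (suc a)    ≈⟨ ιb≈0 ⟩
    0#           ∎)

  x*y≈0⇒y≈0 : ∀ {x y} → ¬ x ≈ 0# → x * y ≈ 0# → y ≈ 0#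
  x*y≈0⇒y≈0 x≉0 xy≈0 = *-cancelˡ x≉0 (trans xy≈0 (sym (zeroʳ _)))

  sum-first-last : ∀ {n} (t : Fin (suc (suc n)) → Carrier) → (∀ i → t (suc (inject₁ i)) ≈ 0#) →
    sum t ≈ t zero + t (fromℕ (suc n))
  sum-first-last {n} t inner = +-congˡ (begin
    sum (t ∘ suc)                                     ≈⟨ sum-init-last (t ∘ suc) ⟩
    sum (t ∘ suc ∘ inject₁) + t (fromℕ (suc n))       ≈⟨ +-congʳ (sum-cong-≋ inner) ⟩
    sum {n} (λ _ → 0#) + t (fromℕ (suc n))            ≈⟨ +-congʳ (sum-replicate-zero n) ⟩
    0# + t (fromℕ (suc n))                            ≈⟨ +-identityˡ _ ⟩
    t (fromℕ (suc n))                                 ∎)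

  ^[k*m]≈[^m]^k : ∀ a k m → a ^ (k ℕ.* m) ≈ (a ^ m) ^ k
  ^[k*m]≈[^m]^k a k m = trans (^-congʳ a (ℕ.*-comm k m)) (sym (^-assocʳ a m k))

  x^e≈1⇒x^[k*e]≈1 : ∀ {a e} k → a ^ e ≈ 1# → a ^ (k ℕ.* e) ≈ 1#
  x^e≈1⇒x^[k*e]≈1 {a} {e} k aᵉ≈1 = trans (^[k*m]≈[^m]^k a k e) (trans (^-congˡ k aᵉ≈1) (1^n≈1 k))

  [-1]^even≈1 : ∀ {n} → 2 ∣ n → (- 1#) ^ n ≈ 1#
  [-1]^even≈1 (divides j ≡.refl) = begin
    (- 1#) ^ (j ℕ.* 2)       ≈⟨ ^[k*m]≈[^m]^k (- 1#) j 2 ⟩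
    ((- 1#) ^ 2) ^ j         ≈⟨ ^-congˡ j [-1]²≈1 ⟩
    1# ^ j                   ≈⟨ 1^n≈1 j ⟩
    1#                       ∎
    where
    [-1]²≈1 : (- 1#) ^ 2 ≈ 1#
    [-1]²≈1 = trans (*-congˡ (*-identityʳ (- 1#))) (trans (-1*x≈-x (- 1#)) (-‿involutive 1#))

  ^-injective-on-roots-of-unity : ∀ {e m a b} → Coprime e m →
    a ^ e ≈ 1# → b ^ e ≈ 1# → a ^ m ≈ b ^ m → a ≈ b
  ^-injective-on-roots-of-unity {e} {m} {a} {b} coprime aᵉ≈1 bᵉ≈1 aᵐ≈bᵐ with coprime-Bézout coprime
  ... | Bézout.-+ k j eq = trans (root aᵉ≈1) (trans (^-congˡ j aᵐ≈bᵐ) (sym (root bᵉ≈1)))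
    where
    root : ∀ {x} → x ^ e ≈ 1# → x ≈ (x ^ m) ^ j
    root {x} xᵉ≈1 = begin
      x                     ≈⟨ *-identityʳ x ⟨
      x * 1#                ≈⟨ *-congˡ (x^e≈1⇒x^[k*e]≈1 k xᵉ≈1) ⟨
      x ^ suc (k ℕ.* e)     ≡⟨ ≡.cong (x ^_) eq ⟩
      x ^ (j ℕ.* m)         ≈⟨ ^[k*m]≈[^m]^k x j m ⟩
      (x ^ m) ^ j           ∎
  ... | Bézout.+- k j eq = begin
      a                     ≈⟨ *-identityʳ a ⟨
      a * 1#                ≈⟨ *-congˡ (inverse-of bᵉ≈1) ⟨
      a * (b * (b ^ m) ^ j) ≈⟨ x∙yz≈y∙xz a b _ ⟩
      b * (a * (b ^ m) ^ j) ≈⟨ *-congˡ (*-congˡ (^-congˡ j aᵐ≈bᵐ)) ⟨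
      b * (a * (a ^ m) ^ j) ≈⟨ *-congˡ (inverse-of aᵉ≈1) ⟩
      b * 1#                ≈⟨ *-identityʳ b ⟩
      b                     ∎
    where
    open import Algebra.Properties.CommutativeSemigroup *-commutativeSemigroup using (x∙yz≈y∙xz)
    inverse-of : ∀ {x} → x ^ e ≈ 1# → x * (x ^ m) ^ j ≈ 1#
    inverse-of {x} xᵉ≈1 = begin
      x * (x ^ m) ^ j       ≈⟨ *-congˡ (^[k*m]≈[^m]^k x j m) ⟨
      x ^ suc (j ℕ.* m)     ≡⟨ ≡.cong (x ^_) eq ⟩
      x ^ (k ℕ.* e)         ≈⟨ x^e≈1⇒x^[k*e]≈1 k xᵉ≈1 ⟩
      1#                    ∎

  module Characteristic {p-1 : ℕ} (p-prime : Prime (suc p-1)) (char : ι (suc p-1) ≈ 0#) where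
    open import Algebra.Properties.CommutativeSemiring.Binomial commutativeSemiring
      using (binomialTerm) renaming (theorem to binomial-theorem)
    open import Algebra.Properties.CommutativeSemiring.Exp commutativeSemiring using (^-distrib-*)

    p : ℕ
    p = suc p-1

    ∣⇒ι≈0 : ∀ {n} → p ∣ n → ι n ≈ 0#
    ∣⇒ι≈0 (divides k ≡.refl) = ι-*-zero k char

    ∤⇒ι≉0 : ∀ {n} → ¬ p ∣ n → ¬ ι n ≈ 0#
    ∤⇒ι≉0 {n} p∤n ιn≈0 with coprime-Bézout (prime∤⇒coprime p-prime p∤n)
    ... | Bézout.+- x y eq = ι≈0∧ι≈0⇒1+a≢b (ι-*-zero y ιn≈0) (ι-*-zero x char) eq
    ... | Bézout.-+ x y eq = ι≈0∧ι≈0⇒1+a≢b (ι-*-zero x char) (ι-*-zero y ιn≈0) eq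

    frobenius : ∀ x y → (x + y) ^ p ≈ x ^ p + y ^ p
    frobenius x y = begin
      (x + y) ^ p                ≈⟨ binomial-theorem p x y ⟩
      sum (binomialTerm x y p)   ≈⟨ sum-first-last (binomialTerm x y p) inner ⟩
      t zero + t (fromℕ p)       ≈⟨ +-cong first last ⟩
      y ^ p + x ^ p              ≈⟨ +-comm _ _ ⟩
      x ^ p + y ^ p              ∎
      where
      t = binomialTerm x y p
      first : t zero ≈ y ^ p
      first = trans (+-identityʳ _) (*-identityˡ _)
      last : t (fromℕ p) ≈ x ^ p
      last = begin
        t (fromℕ p)
          ≡⟨ ≡.cong (λ k → (p C k) Mult.× (x ^ k * y ^ (p ∸ k))) (toℕ-fromℕ p) ⟩
        (p C p) Mult.× (x ^ p * y ^ (p ∸ p))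
          ≈⟨ Mult.×-cong (nCn≡1 p) (*-congˡ (^-congʳ y (ℕ.n∸n≡0 p))) ⟩
        1 Mult.× (x ^ p * 1#)
          ≈⟨ trans (+-identityʳ _) (*-identityʳ _) ⟩
        x ^ p ∎
      inner : ∀ i → t (suc (inject₁ i)) ≈ 0#
      inner i = begin
        (p C k) Mult.× b   ≈⟨ ×≈ι* (p C k) b ⟩
        ι (p C k) * b      ≈⟨ *-congʳ (∣⇒ι≈0 (prime∣pCk p-prime ℕ.z<s k<p)) ⟩
        0# * b             ≈⟨ zeroˡ b ⟩
        0#                 ∎
        where
        k = suc (toℕ (inject₁ i))
        b = x ^ k * y ^ (p ∸ k)
        k<p : k ℕ.< p
        k<p = ℕ.s<s (≡.subst (ℕ._< p-1) (≡.sym (toℕ-inject₁ i)) (toℕ<n i))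

    fermat : ∀ n → ι n ^ p ≈ ι n
    fermat zero    = zeroˡ _
    fermat (suc n) = begin
      (1# + ι n) ^ p     ≈⟨ frobenius 1# (ι n) ⟩
      1# ^ p + ι n ^ p   ≈⟨ +-cong (1^n≈1 p) (fermat n) ⟩
      1# + ι n           ∎

    fermat-unit : ∀ n → ¬ ι n ≈ 0# → ι n ^ p-1 ≈ 1#
    fermat-unit n ιn≉0 = *-cancelˡ ιn≉0 (trans (fermat n) (sym (*-identityʳ (ι n))))

    -- ι m and -ι n = ι ((p - 1) n) are units of the prime field, on which x ↦ xᵐ is injective.
    ιn+ιm*y≈0⇒ιn+ιm≈0 : ∀ {m y} n → Coprime p-1 m → ¬ ι m ≈ 0# → ¬ ι n ≈ 0# →
      y ^ m ≈ 1# → ι n + ι m * y ≈ 0# → ι n + ι m ≈ 0#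
    ιn+ιm*y≈0⇒ιn+ιm≈0 {m} {y} n coprime ιm≉0 ιn≉0 yᵐ≈1 eq = begin
      ι n + ι m      ≈⟨ +-congˡ ιm≈-ιn ⟩
      ι n + - ι n    ≈⟨ -‿inverseʳ (ι n) ⟩
      0#             ∎
      where
      b≈-ιn : ι (p-1 ℕ.* n) ≈ - ι n
      b≈-ιn = trans (ι-homo-* p-1 n) (trans (*-congʳ (+-inverseʳ-unique 1# (ι p-1) char)) (-1*x≈-x (ι n)))
      b≉0 : ¬ ι (p-1 ℕ.* n) ≈ 0#
      b≉0 b≈0 = ιn≉0 (-‿injective (trans (trans (sym b≈-ιn) b≈0) (sym -0#≈0#)))
      ιm*y≈b : ι m * y ≈ ι (p-1 ℕ.* n)
      ιm*y≈b = trans (+-inverseʳ-unique (ι n) (ι m * y) eq) (sym b≈-ιn)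
      ιmᵐ≈bᵐ : ι m ^ m ≈ ι (p-1 ℕ.* n) ^ m
      ιmᵐ≈bᵐ = begin
        ι m ^ m              ≈⟨ *-identityʳ _ ⟨
        ι m ^ m * 1#         ≈⟨ *-congˡ yᵐ≈1 ⟨
        ι m ^ m * y ^ m      ≈⟨ ^-distrib-* (ι m) y m ⟨
        (ι m * y) ^ m        ≈⟨ ^-congˡ m ιm*y≈b ⟩
        ι (p-1 ℕ.* n) ^ m    ∎
      ιm≈-ιn : ι m ≈ - ι n
      ιm≈-ιn = trans (^-injective-on-roots-of-unity coprime (fermat-unit m ιm≉0)
                                                    (fermat-unit (p-1 ℕ.* n) b≉0) ιmᵐ≈bᵐ)
                     b≈-ιn

module PolynomialProperties {c ℓ} (F : Field c ℓ) where
  open Field F hiding (zero)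
  open FieldOps F
  open FieldProperties F
  open import Relation.Binary.Reasoning.Setoid setoid

  eval-cong : ∀ p {x y} → x ≈ y → eval p x ≈ eval p y
  eval-cong []       x≈y = refl
  eval-cong (a ∷ as) x≈y = +-congˡ (*-cong x≈y (eval-cong as x≈y))

  eval-++-cong : ∀ a {u v} → u ≈ v → ∀ x → eval (a ++ [ u ]) x ≈ eval (a ++ [ v ]) x
  eval-++-cong []       u≈v x = +-congʳ u≈v
  eval-++-cong (_ ∷ as) u≈v x = +-congˡ (*-congˡ (eval-++-cong as u≈v x))

  eval-+ₚ : ∀ p q x → eval (p +ₚ q) x ≈ eval p x + eval q x
  eval-+ₚ []       q        x = sym (+-identityˡ _)
  eval-+ₚ (a ∷ as) []       x = sym (+-identityʳ _)
  eval-+ₚ (a ∷ as) (b ∷ bs) x = begin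
    (a + b) + x * eval (as +ₚ bs) x              ≈⟨ +-congˡ (*-congˡ (eval-+ₚ as bs x)) ⟩
    (a + b) + x * (eval as x + eval bs x)        ≈⟨ solve 5 (λ a b x u v →
                                                      (a :+ b) :+ x :* (u :+ v) := (a :+ x :* u) :+ (b :+ x :* v))
                                                      refl a b x (eval as x) (eval bs x) ⟩
    (a + x * eval as x) + (b + x * eval bs x)    ∎

  eval-scale : ∀ c p x → eval (scale c p) x ≈ c * eval p x
  eval-scale c []       x = sym (zeroʳ c)
  eval-scale c (a ∷ as) x = begin
    c * a + x * eval (scale c as) x   ≈⟨ +-congˡ (*-congˡ (eval-scale c as x)) ⟩
    c * a + x * (c * eval as x)       ≈⟨ solve 4 (λ c a x u → c :* a :+ x :* (c :* u) := c :* (a :+ x :* u))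
                                           refl c a x (eval as x) ⟩
    c * (a + x * eval as x)           ∎

  eval-const : ∀ a x → eval (const a) x ≈ a
  eval-const a x = trans (+-congˡ (zeroʳ x)) (+-identityʳ a)

  eval-[p-v]≈0⇒eval-p≈v : ∀ p {v y} → eval (p +ₚ const (- v)) y ≈ 0# → eval p y ≈ v
  eval-[p-v]≈0⇒eval-p≈v p {v} {y} py-v≈0 =
    x∙y⁻¹≈ε⇒x≈y _ _ (trans (sym (trans (eval-+ₚ p (const (- v)) y) (+-congˡ (eval-const (- v) y))))
                           py-v≈0)

  eval-X^ : ∀ n x → eval (X^ n) x ≈ x ^ n
  eval-X^ zero    x = eval-const 1# x
  eval-X^ (suc n) x = trans (+-identityˡ _) (*-congˡ (eval-X^ n x))

  eval-derivFrom-+ₚ : ∀ k p q x →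
    eval (derivFrom k (p +ₚ q)) x ≈ eval (derivFrom k p) x + eval (derivFrom k q) x
  eval-derivFrom-+ₚ k []       q        x = sym (+-identityˡ _)
  eval-derivFrom-+ₚ k (a ∷ as) []       x = sym (+-identityʳ _)
  eval-derivFrom-+ₚ k (a ∷ as) (b ∷ bs) x = begin
    ι k * (a + b) + x * eval (derivFrom (suc k) (as +ₚ bs)) x
      ≈⟨ +-congˡ (*-congˡ (eval-derivFrom-+ₚ (suc k) as bs x)) ⟩
    ι k * (a + b) + x * (u + v)
      ≈⟨ solve 6 (λ i a b x u v → i :* (a :+ b) :+ x :* (u :+ v) := (i :* a :+ x :* u) :+ (i :* b :+ x :* v))
           refl (ι k) a b x u v ⟩
    (ι k * a + x * u) + (ι k * b + x * v) ∎
    where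
    u = eval (derivFrom (suc k) as) x
    v = eval (derivFrom (suc k) bs) x

  eval-deriv-+ₚ : ∀ p q x → eval (deriv (p +ₚ q)) x ≈ eval (deriv p) x + eval (deriv q) x
  eval-deriv-+ₚ []       q        x = sym (+-identityˡ _)
  eval-deriv-+ₚ (a ∷ as) []       x = sym (+-identityʳ _)
  eval-deriv-+ₚ (a ∷ as) (b ∷ bs) x = eval-derivFrom-+ₚ 1 as bs x

  eval-deriv-+ₚ-const : ∀ p a y → eval (deriv (p +ₚ const a)) y ≈ eval (deriv p) y
  eval-deriv-+ₚ-const p a y = trans (eval-deriv-+ₚ p (const a) y) (+-identityʳ _)

  eval-derivFrom-scale : ∀ k c p x → eval (derivFrom k (scale c p)) x ≈ c * eval (derivFrom k p) x
  eval-derivFrom-scale k c []       x = sym (zeroʳ c)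
  eval-derivFrom-scale k c (a ∷ as) x = begin
    ι k * (c * a) + x * eval (derivFrom (suc k) (scale c as)) x
      ≈⟨ +-congˡ (*-congˡ (eval-derivFrom-scale (suc k) c as x)) ⟩
    ι k * (c * a) + x * (c * u)
      ≈⟨ solve 5 (λ i c a x u → i :* (c :* a) :+ x :* (c :* u) := c :* (i :* a :+ x :* u))
           refl (ι k) c a x u ⟩
    c * (ι k * a + x * u) ∎
    where u = eval (derivFrom (suc k) as) x

  eval-deriv-scale : ∀ c p x → eval (deriv (scale c p)) x ≈ c * eval (deriv p) x
  eval-deriv-scale c []       x = sym (zeroʳ c)
  eval-deriv-scale c (a ∷ as) x = eval-derivFrom-scale 1 c as x

  eval-derivFrom-X^ : ∀ j n x → eval (derivFrom j (X^ n)) x ≈ ι (j ℕ.+ n) * x ^ n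
  eval-derivFrom-X^ j zero    x = begin
    ι j * 1# + x * 0#   ≈⟨ eval-const (ι j * 1#) x ⟩
    ι j * 1#            ≡⟨ ≡.cong (λ i → ι i * 1#) (ℕ.+-identityʳ j) ⟨
    ι (j ℕ.+ 0) * 1#    ∎
  eval-derivFrom-X^ j (suc n) x = begin
    ι j * 0# + x * eval (derivFrom (suc j) (X^ n)) x
      ≈⟨ +-cong (zeroʳ (ι j)) (*-congˡ (eval-derivFrom-X^ (suc j) n x)) ⟩
    0# + x * (ι (suc j ℕ.+ n) * x ^ n)
      ≈⟨ solve 3 (λ i x y → con 0 :+ x :* (i :* y) := i :* (x :* y)) refl (ι (suc j ℕ.+ n)) x (x ^ n) ⟩
    ι (suc j ℕ.+ n) * x ^ suc n
      ≡⟨ ≡.cong (λ i → ι i * x ^ suc n) (ℕ.+-suc j n) ⟨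
    ι (j ℕ.+ suc n) * x ^ suc n ∎

  eval-deriv-X^ : ∀ n x → eval (deriv (X^ (suc n))) x ≈ ι (suc n) * x ^ n
  eval-deriv-X^ = eval-derivFrom-X^ 1

  -- Synthetic division, p = (t - r) · quot r p + p(r); eval-quot states this with the
  -- term r · quot r p moved to the left, so that it is a semiring identity.
  quot : Carrier → Poly → Poly
  quot r []                  = []
  quot r (a ∷ [])            = []
  quot r (a ∷ as@(_ ∷ _))    = eval as r ∷ quot r as

  eval-quot : ∀ p r x → eval p x + r * eval (quot r p) x ≈ x * eval (quot r p) x + eval p r
  eval-quot []               r x = solve 2 (λ r x → con 0 :+ r :* con 0 := x :* con 0 :+ con 0) refl r x
  eval-quot (a ∷ [])         r x =
    solve 3 (λ a r x → (a :+ x :* con 0) :+ r :* con 0 := x :* con 0 :+ (a :+ r :* con 0)) refl a r x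
  eval-quot (a ∷ as@(_ ∷ _)) r x = begin
    (a + x * P) + r * (E + x * Q)   ≈⟨ solve 6 (λ a x r P E Q →
                                          (a :+ x :* P) :+ r :* (E :+ x :* Q) := (a :+ r :* E) :+ x :* (P :+ r :* Q))
                                          refl a x r P E Q ⟩
    (a + r * E) + x * (P + r * Q)   ≈⟨ +-congˡ (*-congˡ (eval-quot as r x)) ⟩
    (a + r * E) + x * (x * Q + E)   ≈⟨ solve 5 (λ a x r E Q →
                                          (a :+ r :* E) :+ x :* (x :* Q :+ E) := x :* (E :+ x :* Q) :+ (a :+ r :* E))
                                          refl a x r E Q ⟩
    x * (E + x * Q) + (a + r * E)   ∎
    where
    P = eval as x
    E = eval as r
    Q = eval (quot r as) x

  -- p'(y) is the value at y of the quotient of p by t - y.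
  derivAt : Carrier → Poly → Carrier
  derivAt y p = eval (quot y p) y

  derivAt-∷ : ∀ a p y → derivAt y (a ∷ p) ≈ eval p y + y * derivAt y p
  derivAt-∷ a []      y = solve 1 (λ y → con 0 := con 0 :+ y :* con 0) refl y
  derivAt-∷ a (_ ∷ _) y = refl

  derivAt-quot : ∀ p r y →
    derivAt y p + r * derivAt y (quot r p) ≈ eval (quot r p) y + y * derivAt y (quot r p)
  derivAt-quot []               r y = solve 2 (λ r y → con 0 :+ r :* con 0 := con 0 :+ y :* con 0) refl r y
  derivAt-quot (a ∷ [])         r y = solve 2 (λ r y → con 0 :+ r :* con 0 := con 0 :+ y :* con 0) refl r y
  derivAt-quot (a ∷ as@(_ ∷ _)) r y = begin
    (P + y * D) + r * D′          ≈⟨ +-congˡ (*-congˡ D′≈) ⟩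
    (P + y * D) + r * (Q + y * DQ) ≈⟨ solve 6 (λ P y D r Q DQ →
                                         (P :+ y :* D) :+ r :* (Q :+ y :* DQ) := (P :+ r :* Q) :+ y :* (D :+ r :* DQ))
                                         refl P y D r Q DQ ⟩
    (P + r * Q) + y * (D + r * DQ) ≈⟨ +-cong (eval-quot as r y) (*-congˡ (derivAt-quot as r y)) ⟩
    (y * Q + E) + y * (Q + y * DQ) ≈⟨ solve 4 (λ y Q E DQ →
                                         (y :* Q :+ E) :+ y :* (Q :+ y :* DQ) := (E :+ y :* Q) :+ y :* (Q :+ y :* DQ))
                                         refl y Q E DQ ⟩
    (E + y * Q) + y * (Q + y * DQ) ≈⟨ +-congˡ (*-congˡ D′≈) ⟨
    (E + y * Q) + y * D′           ∎
    where
    P  = eval as y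
    D  = derivAt y as
    E  = eval as r
    Q  = eval (quot r as) y
    DQ = derivAt y (quot r as)
    D′ = derivAt y (E ∷ quot r as)
    D′≈ : D′ ≈ Q + y * DQ
    D′≈ = derivAt-∷ E (quot r as) y

  eval-derivFrom-suc : ∀ j p y → eval (derivFrom (suc j) p) y ≈ eval (derivFrom j p) y + eval p y
  eval-derivFrom-suc j []       y = sym (+-identityʳ 0#)
  eval-derivFrom-suc j (b ∷ bs) y = begin
    (1# + ι j) * b + y * eval (derivFrom (suc (suc j)) bs) y
      ≈⟨ +-congˡ (*-congˡ (eval-derivFrom-suc (suc j) bs y)) ⟩
    (1# + ι j) * b + y * (u + v)
      ≈⟨ solve 5 (λ i b y u v → (con 1 :+ i) :* b :+ y :* (u :+ v) := (i :* b :+ y :* u) :+ (b :+ y :* v))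
           refl (ι j) b y u v ⟩
    (ι j * b + y * u) + (b + y * v) ∎
    where
    u = eval (derivFrom (suc j) bs) y
    v = eval bs y

  derivAt≈eval-deriv : ∀ p y → derivAt y p ≈ eval (deriv p) y
  derivAt≈eval-deriv []               y = refl
  derivAt≈eval-deriv (a ∷ [])         y = refl
  derivAt≈eval-deriv (a ∷ bs@(b ∷ cs)) y = begin
    eval bs y + y * derivAt y bs                   ≈⟨ +-congˡ (*-congˡ (derivAt≈eval-deriv bs y)) ⟩
    eval bs y + y * u                              ≈⟨ solve 4 (λ b y u v →
                                                          v :+ y :* u := (con 0 :* b :+ y :* u) :+ v)
                                                          refl b y u (eval bs y) ⟩
    eval (derivFrom 0 bs) y + eval bs y            ≈⟨ eval-derivFrom-suc 0 bs y ⟨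
    eval (derivFrom 1 bs) y                        ∎
    where u = eval (derivFrom 1 cs) y

  eval-deriv-quot : ∀ p r y →
    eval (deriv p) y + r * eval (deriv (quot r p)) y ≈ eval (quot r p) y + y * eval (deriv (quot r p)) y
  eval-deriv-quot p r y = begin
    eval (deriv p) y + r * D   ≈⟨ +-cong (derivAt≈eval-deriv p y) (*-congˡ (derivAt≈eval-deriv (quot r p) y)) ⟨
    derivAt y p + r * D′       ≈⟨ derivAt-quot p r y ⟩
    eval (quot r p) y + y * D′ ≈⟨ +-congˡ (*-congˡ (derivAt≈eval-deriv (quot r p) y)) ⟩
    eval (quot r p) y + y * D  ∎
    where
    D  = eval (deriv (quot r p)) y
    D′ = derivAt y (quot r p)

  Monic : ℕ → Poly → Set (c ⊔ ℓ)
  Monic n p = Σ[ a ∈ Poly ] Σ[ u ∈ Carrier ] length a ≡ n × u ≈ 1# × p ≡ a ++ [ u ]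

  monic-X^ : ∀ n → Monic n (X^ n)
  monic-X^ zero    = [] , 1# , ≡.refl , refl , ≡.refl
  monic-X^ (suc n) with monic-X^ n
  ... | a , u , len , u≈1 , eq = 0# ∷ a , u , ≡.cong suc len , u≈1 , ≡.cong (0# ∷_) eq

  +ₚ-identityʳ : ∀ p → p +ₚ [] ≡ p
  +ₚ-identityʳ []      = ≡.refl
  +ₚ-identityʳ (_ ∷ _) = ≡.refl

  ++-+ₚ : ∀ a u q → length q ≤ length a →
    Σ[ a′ ∈ Poly ] length a′ ≡ length a × (a ++ [ u ]) +ₚ q ≡ a′ ++ [ u ]
  ++-+ₚ a        u []       _         = a , ≡.refl , +ₚ-identityʳ (a ++ [ u ])
  ++-+ₚ (a ∷ as) u (b ∷ bs) (s≤s q≤a) with ++-+ₚ as u bs q≤a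
  ... | a′ , len , eq = (a + b) ∷ a′ , ≡.cong suc len , ≡.cong ((a + b) ∷_) eq

  monic-+ₚ : ∀ {n p} q → Monic n p → length q ≤ n → Monic n (p +ₚ q)
  monic-+ₚ q (a , u , ≡.refl , u≈1 , ≡.refl) q≤n with ++-+ₚ a u q q≤n
  ... | a′ , len , eq = a′ , u , len , u≈1 , eq

  quot-++ : ∀ r a as u →
    Σ[ a′ ∈ Poly ] length a′ ≡ length as × quot r (a ∷ as ++ [ u ]) ≡ a′ ++ [ u + r * 0# ]
  quot-++ r a []       u = [] , ≡.refl , ≡.refl
  quot-++ r a (b ∷ bs) u with quot-++ r b bs u
  ... | a′ , len , eq = eval (b ∷ bs ++ [ u ]) r ∷ a′ , ≡.cong suc len , ≡.cong (_ ∷_) eq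

  monic-quot : ∀ {n p} r → Monic (suc n) p → Monic n (quot r p)
  monic-quot r (a ∷ as , u , ≡.refl , u≈1 , ≡.refl) with quot-++ r a as u
  ... | a′ , len , eq = a′ , u + r * 0# , len , trans (+-congˡ (zeroʳ r)) (trans (+-identityʳ u) u≈1) , eq

  coeff-++-length : ∀ a u → coeff (a ++ [ u ]) (length a) ≡ u
  coeff-++-length []       u = ≡.refl
  coeff-++-length (_ ∷ as) u = coeff-++-length as u

  coeff-++->length : ∀ a u k → length a ℕ.< k → coeff (a ++ [ u ]) k ≡ 0#
  coeff-++->length []       u (suc k) _         = ≡.refl
  coeff-++->length (_ ∷ as) u (suc k) (s≤s a<k) = coeff-++->length as u k a<k

  monic⇒degree : ∀ {n p} → Monic n p → HasDegree p n
  monic⇒degree (a , u , ≡.refl , u≈1 , ≡.refl) =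
    (λ u≈0 → 1≉0 (trans (sym u≈1) (trans (reflexive (≡.sym (coeff-++-length a u))) u≈0))) ,
    (λ k a<k → reflexive (coeff-++->length a u k a<k))

module Splitting {c ℓ} (K : AlgClosedField c ℓ) where
  open AlgClosedField K
  open FieldProperties field'
  open PolynomialProperties field'
  open import Relation.Binary.Reasoning.Setoid setoid

  Separable : Poly → Set (c ⊔ ℓ)
  Separable p = ∀ y → eval p y ≈ 0# → ¬ eval (deriv p) y ≈ 0#

  monic-root : ∀ {n p} → Monic (suc n) p → Σ[ x ∈ Carrier ] eval p x ≈ 0#
  monic-root (a@(_ ∷ _) , u , _ , u≈1 , ≡.refl) with closed a (s≤s z≤n)
  ... | x , root = x , trans (eval-++-cong a u≈1 x) root

  quot-root⇒root : ∀ p {r y} → eval p r ≈ 0# → eval (quot r p) y ≈ 0# → eval p y ≈ 0#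
  quot-root⇒root p {r} {y} pr≈0 qy≈0 = +-cancelʳ (r * eval (quot r p) y) (eval p y) 0# (begin
    eval p y + r * eval (quot r p) y   ≈⟨ eval-quot p r y ⟩
    y * eval (quot r p) y + eval p r   ≈⟨ +-cong (*-congˡ qy≈0) pr≈0 ⟩
    y * 0# + 0#                        ≈⟨ solve 2 (λ r y → y :* con 0 :+ con 0 := con 0 :+ r :* con 0) refl r y ⟩
    0# + r * 0#                        ≈⟨ +-congˡ (*-congˡ qy≈0) ⟨
    0# + r * eval (quot r p) y         ∎)

  separable-quot : ∀ p {r} → Separable p → eval p r ≈ 0# → Separable (quot r p)
  separable-quot p {r} sep pr≈0 y qy≈0 q′y≈0 =
    sep y (quot-root⇒root p pr≈0 qy≈0) (+-cancelʳ (r * q′y) (eval (deriv p) y) 0# (begin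
    eval (deriv p) y + r * q′y         ≈⟨ eval-deriv-quot p r y ⟩
    eval (quot r p) y + y * q′y        ≈⟨ +-cong qy≈0 (*-congˡ q′y≈0) ⟩
    0# + y * 0#                        ≈⟨ solve 2 (λ r y → con 0 :+ y :* con 0 := con 0 :+ r :* con 0) refl r y ⟩
    0# + r * 0#                        ≈⟨ +-congˡ (*-congˡ q′y≈0) ⟨
    0# + r * q′y                       ∎))
    where q′y = eval (deriv (quot r p)) y

  -- at y = r the product rule for p = (t - r) · quot r p + p(r) reads p'(r) = (quot r p)(r)
  separable-root∉quot : ∀ p {r} → Separable p → eval p r ≈ 0# → ¬ eval (quot r p) r ≈ 0#
  separable-root∉quot p {r} sep pr≈0 qr≈0 =
    sep r pr≈0 (trans (+-cancelʳ (r * eval (deriv (quot r p)) r) _ _ (eval-deriv-quot p r r)) qr≈0)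

  distinct-∷ : ∀ {n x} {s : Fin n → Carrier} → (∀ j → ¬ x ≈ s j) → Distinct s → Distinct (x Vector.∷ s)
  distinct-∷ x∉s distinct zero    zero    i≢j = λ _ → i≢j ≡.refl
  distinct-∷ x∉s distinct zero    (suc j) _   = x∉s j
  distinct-∷ x∉s distinct (suc i) zero    _   = λ sᵢ≈x → x∉s i (sym sᵢ≈x)
  distinct-∷ x∉s distinct (suc i) (suc j) i≢j = distinct i j (λ i≡j → i≢j (≡.cong suc i≡j))

  monic-separable⇒distinctZeros : ∀ n {p} → Monic n p → Separable p → HasDistinctZeros p n
  monic-separable⇒distinctZeros zero    _     _   = (λ ()) , (λ ()) , (λ ())
  monic-separable⇒distinctZeros (suc n) {p} monic sep
    with r , pr≈0 ← monic-root monic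
    with s , distinct , zeros ← monic-separable⇒distinctZeros n (monic-quot r monic) (separable-quot p sep pr≈0)
    = r Vector.∷ s , distinct-∷ r∉s distinct ,
      λ { zero → pr≈0 ; (suc i) → quot-root⇒root p pr≈0 (zeros i) }
    where
    r∉s : ∀ j → ¬ r ≈ s j
    r∉s j r≈sⱼ = separable-root∉quot p sep pr≈0 (trans (eval-cong (quot r p) r≈sⱼ) (zeros j))

module Trinomial {c ℓ} (K : AlgClosedField c ℓ)
                 {p-1 : ℕ} (p-prime : Prime (suc p-1)) (char : CharP K (suc p-1))
                 {k : ℕ} (p∤d : ¬ suc p-1 ∣ suc (suc k)) (p∤m : ¬ suc p-1 ∣ suc k)
                 (coprime : Coprime p-1 (suc k)) where
  open AlgClosedField K hiding (zero)
  open FieldProperties field'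
  open PolynomialProperties field'
  open Splitting K
  open Characteristic p-prime char
  open import Relation.Binary.Reasoning.Setoid setoid

  m d : ℕ
  m = suc k
  d = suc m

  linear-part : Poly
  linear-part = scale (- ι d) (X^ 1) +ₚ const (- 1#)

  f : Poly
  f = fpoly d

  ιd≉0 : ¬ ι d ≈ 0#
  ιd≉0 = ∤⇒ι≉0 p∤d

  ιm≉0 : ¬ ι m ≈ 0#
  ιm≉0 = ∤⇒ι≉0 p∤m

  monic-f : Monic d f
  monic-f = monic-+ₚ linear-part (monic-X^ d) (s≤s (s≤s z≤n))

  eval-f : ∀ y → eval f y ≈ y ^ d + (- ι d * y + - 1#)
  eval-f y = begin
    eval f y
      ≈⟨ eval-+ₚ (X^ d) linear-part y ⟩
    eval (X^ d) y + eval linear-part y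
      ≈⟨ +-cong (eval-X^ d y) (eval-+ₚ (scale (- ι d) (X^ 1)) (const (- 1#)) y) ⟩
    y ^ d + (eval (scale (- ι d) (X^ 1)) y + eval (const (- 1#)) y)
      ≈⟨ +-congˡ (+-cong (eval-scale (- ι d) (X^ 1) y) (eval-const (- 1#) y)) ⟩
    y ^ d + (- ι d * eval (X^ 1) y + - 1#)
      ≈⟨ +-congˡ (+-congʳ (*-congˡ (trans (eval-X^ 1 y) (*-identityʳ y)))) ⟩
    y ^ d + (- ι d * y + - 1#) ∎

  eval-f+dy+1 : ∀ y → eval f y + (ι d * y + 1#) ≈ y ^ d
  eval-f+dy+1 y = begin
    eval f y + (ι d * y + 1#)                     ≈⟨ +-congʳ (eval-f y) ⟩
    (y ^ d + (- ι d * y + - 1#)) + (ι d * y + 1#) ≈⟨ solve 5 (λ Y D′ y M D →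
                                                       (Y :+ (D′ :* y :+ M)) :+ (D :* y :+ con 1)
                                                       := Y :+ ((D′ :+ D) :* y :+ (M :+ con 1)))
                                                       refl (y ^ d) (- ι d) y (- 1#) (ι d) ⟩
    y ^ d + ((- ι d + ι d) * y + (- 1# + 1#))     ≈⟨ +-congˡ (+-cong (trans (*-congʳ (-‿inverseˡ (ι d)))
                                                                             (zeroˡ y))
                                                                      (-‿inverseˡ 1#)) ⟩
    y ^ d + (0# + 0#)                             ≈⟨ trans (+-congˡ (+-identityʳ 0#)) (+-identityʳ _) ⟩
    y ^ d                                         ∎

  eval-f′+d : ∀ y → eval (deriv f) y + ι d ≈ ι d * y ^ m
  eval-f′+d y = begin
    eval (deriv f) y + ι d                           ≈⟨ +-congʳ (eval-deriv-+ₚ (X^ d) linear-part y) ⟩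
    (eval (deriv (X^ d)) y + eval (deriv linear-part) y) + ι d
                                                     ≈⟨ +-congʳ (+-cong (eval-deriv-X^ m y) linear-part′) ⟩
    (ι d * y ^ m + - ι d * ((1# + 0#) * 1#)) + ι d   ≈⟨ solve 3 (λ Y D′ D →
                                                          (Y :+ D′ :* ((con 1 :+ con 0) :* con 1)) :+ D
                                                          := Y :+ (D′ :+ D))
                                                          refl (ι d * y ^ m) (- ι d) (ι d) ⟩
    ι d * y ^ m + (- ι d + ι d)                      ≈⟨ trans (+-congˡ (-‿inverseˡ (ι d))) (+-identityʳ _) ⟩
    ι d * y ^ m                                      ∎
    where
    linear-part′ : eval (deriv linear-part) y ≈ - ι d * ((1# + 0#) * 1#)
    linear-part′ = trans (eval-deriv-+ₚ-const (scale (- ι d) (X^ 1)) (- 1#) y)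
                         (trans (eval-deriv-scale (- ι d) (X^ 1) y) (*-congˡ (eval-deriv-X^ 0 y)))

  f′≈0⇒root-of-unity : ∀ {y} → eval (deriv f) y ≈ 0# → y ^ m ≈ 1#
  f′≈0⇒root-of-unity {y} f′y≈0 = *-cancelˡ ιd≉0 (begin
    ι d * y ^ m             ≈⟨ eval-f′+d y ⟨
    eval (deriv f) y + ι d  ≈⟨ +-congʳ f′y≈0 ⟩
    0# + ι d                ≈⟨ +-identityˡ (ι d) ⟩
    ι d                     ≈⟨ *-identityʳ (ι d) ⟨
    ι d * 1#                ∎)

  root-of-unity⇒f′≈0 : ∀ {y} → y ^ m ≈ 1# → eval (deriv f) y ≈ 0#
  root-of-unity⇒f′≈0 {y} yᵐ≈1 = +-cancelʳ (ι d) _ _ (begin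
    eval (deriv f) y + ι d  ≈⟨ eval-f′+d y ⟩
    ι d * y ^ m             ≈⟨ *-congˡ yᵐ≈1 ⟩
    ι d * 1#                ≈⟨ *-identityʳ (ι d) ⟩
    ι d                     ≈⟨ +-identityˡ (ι d) ⟨
    0# + ι d                ∎)

  critical-value : ∀ {y} → y ^ m ≈ 1# → (eval f y + 1#) + ι m * y ≈ 0#
  critical-value {y} yᵐ≈1 = +-cancelʳ y _ _ (begin
    ((eval f y + 1#) + ι m * y) + y   ≈⟨ solve 3 (λ F M y →
                                             ((F :+ con 1) :+ M :* y) :+ y := F :+ ((con 1 :+ M) :* y :+ con 1))
                                             refl (eval f y) (ι m) y ⟩
    eval f y + (ι d * y + 1#)         ≈⟨ eval-f+dy+1 y ⟩
    y * y ^ m                         ≈⟨ trans (*-congˡ yᵐ≈1) (*-identityʳ y) ⟩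
    y                                 ≈⟨ +-identityˡ y ⟨
    0# + y                            ∎)

  critical-values-injective : ∀ {y y′} → y ^ m ≈ 1# → y′ ^ m ≈ 1# → eval f y ≈ eval f y′ → y ≈ y′
  critical-values-injective {y} {y′} yᵐ≈1 y′ᵐ≈1 fy≈fy′ =
    *-cancelˡ ιm≉0 (+-cancelˡ (eval f y + 1#) _ _ (begin
      (eval f y + 1#) + ι m * y     ≈⟨ critical-value yᵐ≈1 ⟩
      0#                            ≈⟨ critical-value y′ᵐ≈1 ⟨
      (eval f y′ + 1#) + ι m * y′   ≈⟨ +-congʳ (+-congʳ fy≈fy′) ⟨
      (eval f y + 1#) + ι m * y′    ∎))

  critical-value-in-prime-field : ∀ n {y} → ¬ ι n ≈ 0# → y ^ m ≈ 1# →
    eval f y + 1# ≈ ι n → ι (n ℕ.+ m) ≈ 0#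
  critical-value-in-prime-field n {y} ιn≉0 yᵐ≈1 fy+1≈ιn = trans (ι-homo-+ n m)
    (ιn+ιm*y≈0⇒ιn+ιm≈0 n coprime ιm≉0 ιn≉0 yᵐ≈1
      (trans (+-congʳ (sym fy+1≈ιn)) (critical-value yᵐ≈1)))

  RegularValue : Carrier → Set (c ⊔ ℓ)
  RegularValue v = ∀ y → y ^ m ≈ 1# → ¬ eval f y ≈ v

  regular⇒separable : ∀ {v} → RegularValue v → Separable (f +ₚ const (- v))
  regular⇒separable {v} regular y f[y]-v≈0 f′[y]≈0 = regular y
    (f′≈0⇒root-of-unity (trans (sym (eval-deriv-+ₚ-const f (- v) y)) f′[y]≈0))
    (eval-[p-v]≈0⇒eval-p≈v f f[y]-v≈0)

  regular-fiber : ∀ v → RegularValue v →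
    Σ[ r ∈ (Fin d → Carrier) ] Distinct r × (∀ i → eval f (r i) ≈ v)
  regular-fiber v regular =
    let r , distinct , zeros = monic-separable⇒distinctZeros d (monic-+ₚ (const (- v)) monic-f (s≤s z≤n))
                                                            (regular⇒separable regular)
    in r , distinct , λ i → eval-[p-v]≈0⇒eval-p≈v f {v} {r i} (zeros i)

  X^m-1≈0⇒root-of-unity : ∀ {y} → eval (X^ m +ₚ const (- 1#)) y ≈ 0# → y ^ m ≈ 1#
  X^m-1≈0⇒root-of-unity {y} yᵐ-1≈0 = trans (sym (eval-X^ m y)) (eval-[p-v]≈0⇒eval-p≈v (X^ m) yᵐ-1≈0)

  X^m-1-separable : Separable (X^ m +ₚ const (- 1#))
  X^m-1-separable y yᵐ-1≈0 myᵏ≈0 = 1≉0 (begin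
    1#          ≈⟨ X^m-1≈0⇒root-of-unity yᵐ-1≈0 ⟨
    y * y ^ k   ≈⟨ *-congˡ yᵏ≈0 ⟩
    y * 0#      ≈⟨ zeroʳ y ⟩
    0#          ∎)
    where
    yᵏ≈0 : y ^ k ≈ 0#
    yᵏ≈0 = x*y≈0⇒y≈0 ιm≉0
      (trans (sym (eval-deriv-X^ k y)) (trans (sym (eval-deriv-+ₚ-const (X^ m) (- 1#) y)) myᵏ≈0))

  roots-of-unity : Σ[ z ∈ (Fin m → Carrier) ] Distinct z × (∀ i → z i ^ m ≈ 1#)
  roots-of-unity =
    let z , distinct , zeros = monic-separable⇒distinctZeros m (monic-+ₚ (const (- 1#)) (monic-X^ m) (s≤s z≤n))
                                                            X^m-1-separable
    in z , distinct , λ i → X^m-1≈0⇒root-of-unity (zeros i)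

  zero-regular : RegularValue 0#
  zero-regular y yᵐ≈1 fy≈0 =
    ιd≉0 (critical-value-in-prime-field 1 ι1≉0 yᵐ≈1 (trans (+-congʳ fy≈0) (+-comm 0# 1#)))
    where
    ι1≉0 : ¬ ι 1 ≈ 0#
    ι1≉0 ι1≈0 = 1≉0 (trans (sym (+-identityʳ 1#)) ι1≈0)

  lefschetz : LefschetzType f
  lefschetz =
    let z , distinct , zᵐ≈1 = roots-of-unity
    in d , monic⇒degree monic-f , s≤s z≤n , regular-fiber 0# zero-regular ,
       z , distinct , (λ i → root-of-unity⇒f′≈0 (zᵐ≈1 i)) ,
       λ i j i≢j fzᵢ≈fzⱼ → distinct i j i≢j (critical-values-injective (zᵐ≈1 i) (zᵐ≈1 j) fzᵢ≈fzⱼ)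

  f[0]≈-1 : eval f 0# ≈ - 1#
  f[0]≈-1 = +-inverseˡ-unique (eval f 0#) 1# (begin
    eval f 0# + 1#               ≈⟨ +-congˡ (trans (+-congʳ (zeroʳ (ι d))) (+-identityˡ 1#)) ⟨
    eval f 0# + (ι d * 0# + 1#)  ≈⟨ eval-f+dy+1 0# ⟩
    0# * 0# ^ m                  ≈⟨ zeroˡ _ ⟩
    0#                           ∎)

  even⇒f[-1]≈ιd : 2 ∣ d → eval f (- 1#) ≈ ι d
  even⇒f[-1]≈ιd 2∣d = x∙y⁻¹≈ε⇒x≈y _ _ (+-cancelʳ 1# _ _ (begin
    (eval f (- 1#) + - ι d) + 1#        ≈⟨ +-assoc _ _ _ ⟩
    eval f (- 1#) + (- ι d + 1#)        ≈⟨ +-congˡ (+-congʳ d*[-1]≈-d) ⟨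
    eval f (- 1#) + (ι d * - 1# + 1#)   ≈⟨ eval-f+dy+1 (- 1#) ⟩
    (- 1#) ^ d                          ≈⟨ [-1]^even≈1 2∣d ⟩
    1#                                  ≈⟨ +-identityˡ 1# ⟨
    0# + 1#                             ∎))
    where
    d*[-1]≈-d : ι d * - 1# ≈ - ι d
    d*[-1]≈-d = trans (sym (-‿distribʳ-* (ι d) 1#)) (-‿cong (*-identityʳ (ι d)))

  module _ (2<p : 2 ℕ.< suc p-1) (p∤d+1 : ¬ suc p-1 ∣ suc d) where

    f[-1]≈ιd : eval f (- 1#) ≈ ι d
    f[-1]≈ιd = even⇒f[-1]≈ιd (coprime-to-even⇒2∣1+n coprime (odd-prime⇒2∣p-1 p-prime 2<p))

    f[0]≉f[-1] : ¬ eval f 0# ≈ eval f (- 1#)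
    f[0]≉f[-1] f[0]≈f[-1] = ∤⇒ι≉0 p∤d+1 (begin
      1# + ι d     ≈⟨ +-congˡ (trans (sym f[-1]≈ιd) (trans (sym f[0]≈f[-1]) f[0]≈-1)) ⟩
      1# + - 1#    ≈⟨ -‿inverseʳ 1# ⟩
      0#           ∎)

    f[0]-regular : RegularValue (eval f 0#)
    f[0]-regular y yᵐ≈1 fy≈f[0] = 1≉0 (begin
      1#          ≈⟨ yᵐ≈1 ⟨
      y * y ^ k   ≈⟨ *-congʳ y≈0 ⟩
      0# * y ^ k  ≈⟨ zeroˡ _ ⟩
      0#          ∎)
      where
      fy+1≈0 : eval f y + 1# ≈ 0#
      fy+1≈0 = trans (+-congʳ (trans fy≈f[0] f[0]≈-1)) (-‿inverseˡ 1#)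
      y≈0 : y ≈ 0#
      y≈0 = x*y≈0⇒y≈0 ιm≉0
        (trans (sym (+-identityˡ _)) (trans (+-congʳ (sym fy+1≈0)) (critical-value yᵐ≈1)))

    f[-1]-regular : RegularValue (eval f (- 1#))
    f[-1]-regular y yᵐ≈1 fy≈f[-1] =
      ∤⇒ι≉0 p∤2d (critical-value-in-prime-field (suc d) (∤⇒ι≉0 p∤d+1) yᵐ≈1 (begin
        eval f y + 1#   ≈⟨ +-congʳ (trans fy≈f[-1] f[-1]≈ιd) ⟩
        ι d + 1#        ≈⟨ +-comm (ι d) 1# ⟩
        ι (suc d)       ∎))
      where
      p∤2d : ¬ suc p-1 ∣ suc d ℕ.+ m
      p∤2d p∣2d with euclidsLemma 2 d p-prime (≡.subst (suc p-1 ∣_) (2+m+m≡2*[1+m] m) p∣2d)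
      ... | inj₁ p∣2 = ℕ.<⇒≱ 2<p (∣⇒≤ p∣2)
      ... | inj₂ p∣d = p∤d p∣d

    katz-lefschetz : KatzLefschetzType Sbad f
    katz-lefschetz = d , monic⇒degree monic-f , lefschetz , separates , nonzero , fibers
      where
      separates : ∀ i j → ¬ lookup Sbad i ≈ lookup Sbad j → ¬ eval f (lookup Sbad i) ≈ eval f (lookup Sbad j)
      separates zero       zero       s≉s = λ _ → s≉s refl
      separates zero       (suc zero) _   = f[0]≉f[-1]
      separates (suc zero) zero       _   = λ f[-1]≈f[0] → f[0]≉f[-1] (sym f[-1]≈f[0])
      separates (suc zero) (suc zero) s≉s = λ _ → s≉s refl

      nonzero : ∀ i → ¬ eval f (lookup Sbad i) ≈ 0#
      nonzero zero       f[0]≈0  = 1≉0 (-‿injective (trans (sym f[0]≈-1) (trans f[0]≈0 (sym -0#≈0#))))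
      nonzero (suc zero) f[-1]≈0 = ιd≉0 (trans (sym f[-1]≈ιd) f[-1]≈0)

      fibers : ∀ i → Σ[ r ∈ (Fin d → Carrier) ] Distinct r × (∀ j → eval f (r j) ≈ eval f (lookup Sbad i))
      fibers zero       = regular-fiber (eval f 0#) f[0]-regular
      fibers (suc zero) = regular-fiber (eval f (- 1#)) f[-1]-regular

open import Data.Nat using (ℕ; _≤_; _*_; _+_; _∸_)
open import Data.Nat.Divisibility using (_∣_)
open import Data.Nat.GCD using (gcd)
open import Data.Nat.Primality using (Prime)
open import Data.Product using (_×_)
open import Relation.Nullary using (¬_)
open import Relation.Binary.PropositionalEquality using (_≡_)

lemma4p2 : ∀ {c ℓ} (K : AlgClosedField c ℓ) (p d : ℕ) →
    Prime p → 5 ≤ p → CharP K p → 1 ≤ d →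
    ¬ (p ∣ d * (d ∸ 1)) → gcd (p ∸ 1) (d ∸ 1) ≡ 1 →
    AlgClosedField.LefschetzType K (AlgClosedField.fpoly K d)
    × (¬ (p ∣ d + 1) →
       AlgClosedField.KatzLefschetzType K (AlgClosedField.Sbad K) (AlgClosedField.fpoly K d))
lemma4p2 K zero      _             _       ()
lemma4p2 K (suc p-1) zero          _       _   _    ()
lemma4p2 K (suc p-1) (suc zero)    _       _   _    _ p∤d[d-1] _     = contradiction (suc p-1 ∣0) p∤d[d-1]
lemma4p2 K (suc p-1) (suc (suc k)) p-prime 5≤p char _ p∤d[d-1] gcd≡1 =
  lefschetz , λ p∤d+1 → katz-lefschetz 2<p (≡.subst (¬_ ∘ (suc p-1 ∣_)) (ℕ.+-comm (suc (suc k)) 1) p∤d+1)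
  where
  p∤d : ¬ suc p-1 ∣ suc (suc k)
  p∤d p∣d = p∤d[d-1] (∣m⇒∣m*n (suc k) p∣d)
  p∤m : ¬ suc p-1 ∣ suc k
  p∤m p∣m = p∤d[d-1] (∣n⇒∣m*n (suc (suc k)) p∣m)
  2<p : 2 ℕ.< suc p-1
  2<p = ℕ.≤-trans (s≤s (s≤s (s≤s z≤n))) 5≤p
  open Trinomial K p-prime char p∤d p∤m (gcd≡1⇒coprime gcd≡1)
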